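{- Let $n \ge 4$ be even, let $D_n = \langle x, t \mid x^n = t^2 = 1,\ txt = x^{ -1}\rangle$ and $C_n = \langle x \rangle \le D_n$. Let $M$ be a maximal skew set in $C_n$ containing precisely one element from each coset of $\langle x^{n/2}\rangle$ in $C_n$ other than $\langle x^{n/2}\rangle$ itself, and set $S = M \cup Mt \subseteq D_n$, where $Mt = \{mt : m \in M\}$. Then $S \cup \{t\}$ and $S \cup \{x^{n/2}t\}$ are both $(2n, n-1, \frac{n-2}{2})$ sum sets in $D_n$ which are type 1 with respect to $Z(D_n) = \{1, x^{n/2}\}$.
   Context: A subset $T$ of a group is skew if $T \cap T^{(-1)} = \varnothing$, where $T^{(-1)}=\{s^{ -1}: s\in T\}$; a maximal skew set is a skew subset not properly contained in any other skew subset. For a finite group $X$ of order $w$, $T\subseteq X$ with $|T|=k$ is a $(w,k,\mu)$ sum set if every nonidentity element $a\in X$ admits exactly $\mu$ ordered pairs $(y_1,y_2)\in T\times T$ with $y_1y_2 = a$. For a normal subgroup $N$ of order $2$, a sum set $T$ is type 1 with respect to $N$ if $T\cap N=\varnothing$ and $T$ meets each other coset of $N$ in $0$ or $1$ elements. -}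

module Defs where

open import Data.Nat using (ℕ; zero; suc; _+_; _*_; _∸_; _≤_; NonZero)
open import Data.Nat.DivMod using (_mod_; _/_)
open import Data.Fin as F using (Fin; toℕ)
open import Data.Bool using (Bool; true; false; _∧_; _∨_; not; if_then_else_; _xor_)
open import Data.Product using (_×_; _,_; proj₁; proj₂)
open import Data.List using (List; []; _∷_; filter; length; allFin; cartesianProduct; map; concatMap)
open import Relation.Nullary.Decidable using (⌊_⌋)
open import Relation.Binary.PropositionalEquality using (_≡_)
open import Data.Bool.Properties using () renaming (_≟_ to _≟B_)
open import Relation.Unary using (Pred)
open import Function using (_∘_)

-- The cyclic group C_n = ⟨x⟩ ≅ ℤ/n, element x^i encoded as i : Fin n.

module _ (n : ℕ) .{{_ : NonZero n}} where

  C : Set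
  C = Fin n

  _+C_ : C → C → C
  i +C j = (toℕ i + toℕ j) mod n

  invC : C → C
  invC i = (n ∸ toℕ i) mod n

  zeroC : C
  zeroC = 0 mod n

  halfC : C
  halfC = (n / 2) mod n

  -- The dihedral group D_n: (i , b) encodes x^i t^b (b = true means t).
  -- Multiplication: x^i t^a · x^j t^b = x^{i + (-1)^a j} t^{a+b}
  -- (using t x^j = x^{-j} t).

  D : Set
  D = Fin n × Bool

  _·D_ : D → D → D
  (i , a) ·D (j , b) = ((if a then i +C invC j else i +C j) , (a xor b))

  eD : D
  eD = (zeroC , false)

  invD : D → D
  invD (i , false) = (invC i , false)
  invD (i , true)  = (i , true)

  _==D_ : D → D → Bool
  (i , a) ==D (j , b) = ⌊ i F.≟ j ⌋ ∧ ⌊ a ≟B b ⌋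

  allD : List D
  allD = concatMap (λ i → (i , false) ∷ (i , true) ∷ []) (allFin n)

  SubC : Set
  SubC = C → Bool

  SubD : Set
  SubD = D → Bool

  IsSkewC : SubC → Set
  IsSkewC T = ∀ i → T i ≡ true → T (invC i) ≡ false

  IsMaximalSkewC : SubC → Set
  IsMaximalSkewC M =
    IsSkewC M ×
    (∀ (T : SubC) → IsSkewC T → (∀ i → M i ≡ true → T i ≡ true) →
       ∀ i → T i ≡ true → M i ≡ true)

  inHalfSub : C → Bool
  inHalfSub i = ⌊ i F.≟ zeroC ⌋ ∨ ⌊ i F.≟ halfC ⌋

  OneFromEachNontrivialCoset : SubC → Set
  OneFromEachNontrivialCoset M =
    ∀ i → inHalfSub i ≡ false →
      length (filter (λ j → M j ≟B true)
                     (i ∷ (i +C halfC) ∷ [])) ≡ 1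

  MuMt : SubC → SubD
  MuMt M (i , _) = M i

  addElem : SubD → D → SubD
  addElem S g h = S h ∨ (h ==D g)

  tD : D
  tD = (zeroC , true)

  xhalf-t : D
  xhalf-t = (halfC , true)

  card : SubD → ℕ
  card T = length (filter (λ g → T g ≟B true) allD)

  reps : SubD → D → ℕ
  reps T a = length (filter (λ p → (T (proj₁ p) ∧ T (proj₂ p)
                                       ∧ ((proj₁ p ·D proj₂ p) ==D a)) ≟B true)
                            (cartesianProduct allD allD))

  IsSumSet : ℕ → ℕ → ℕ → SubD → Set
  IsSumSet w k μ T =
    (length allD ≡ w) × (card T ≡ k) ×
    (∀ a → (a ==D eD) ≡ false → reps T a ≡ μ)

  IsType1 : SubD → SubD → Set
  IsType1 N T =
    (∀ g → N g ≡ true → T g ≡ false) ×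
    (∀ g → N g ≡ false →
       length (filter (λ h → (T h ∧ N (invD g ·D h)) ≟B true) allD) ≤ 1)

  ZD : SubD
  ZD h = (h ==D eD) ∨ (h ==D (halfC , false))

-- Write h = n/2, H = {0, h} ⊆ ℤ/n (so that Z(D_n) = {x^i : i ∈ H}) and m for the indicator
-- function of M. Maximality of the skew set M says that M, −M and H partition ℤ/n, and the
-- coset condition says that M, M + h and H do; in particular 2|M| + 2 = n.
-- In S = M ∪ Mt an element x^k t^b has Σᵢ m(i) (m(k − i) + m(i − k)) = |M| − m(k) − m(k + h)
-- representations, by the first partition applied to i − k. Adjoining the involution
-- g₀ = x^c t (c ∈ H) adds m(k + c) + m(c − k) representations of every g ≠ 1, and by both
-- partitions this equals m(k) + m(k + h). Finally a coset of Z(D_n) meets S ∪ {g₀} in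
-- m(i) + m(i + h) elements, plus one for the coset {x^i t, x^(i+h) t} when i ∈ H.
module Submission where

open import Algebra.Bundles using (AbelianGroup; Group)
import Algebra.Properties.AbelianGroup as AbelianGroupProperties
import Algebra.Properties.Group as GroupProperties
open import Data.Bool using (Bool; true; false; _∧_; _∨_; not; _xor_)
open import Data.Bool.Properties
  using (¬-not; xor-assoc; ∧-zeroʳ; ∧-identityʳ; ∨-identityʳ) renaming (_≟_ to _≟B_)
open import Data.Fin using (Fin; zero; suc; toℕ; _≟_)
open import Data.Fin.Permutation using (permutation)
open import Data.Fin.Properties using (0≢1+n; suc-injective; toℕ-fromℕ<; toℕ-injective; toℕ<n)
open import Data.List
  using (List; []; _∷_; _++_; map; filter; length; tabulate; allFin; cartesianProduct; concatMap)
open import Data.List.Properties using (map-++; map-∘)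
open import Data.Nat using (ℕ; zero; suc; _+_; _*_; _∸_; _/_; _≤_; _<_; NonZero; >-nonZero⁻¹; ≢-nonZero⁻¹)
open import Data.Nat.Divisibility using (_∣_; divides)
open import Data.Nat.DivMod
  using (_%_; _mod_; %-distribˡ-+; m%n%n≡m%n; m<n⇒m%n≡m; n%n≡0; m*n/n≡m; m≤n⇒[n∸m]%m≡n%m)
open import Data.Nat.ListAction using () renaming (sum to sumˡ)
open import Data.Nat.ListAction.Properties using () renaming (sum-++ to sumˡ-++)
open import Data.Nat.Properties
  using ( +-*-semiring; +-commutativeSemigroup; +-assoc; +-comm; +-identityʳ; +-suc; +-cancelʳ-≡
        ; *-comm; *-assoc; *-identityˡ; *-identityʳ; *-zeroʳ; *-distribˡ-+
        ; <-cmp; <⇒≤; <⇒≱; ≤-reflexive; +-mono-<; ∸-monoˡ-<; m≤m+n; m<m+n; n≢0⇒n>0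
        ; m+n≡0⇒m≡0; m∸n≡0⇒m≤n; m+n∸n≡m; m+[n∸m]≡n )
open import Data.Nat.Solver using (module +-*-Solver)
open import Data.Product using (_×_; _,_; proj₁; proj₂)
open import Data.Sum using (_⊎_; inj₁; inj₂)
open import Algebra.Properties.CommutativeSemigroup +-commutativeSemigroup
  using () renaming (interchange to +-interchange)
open import Algebra.Properties.Semiring.Sum +-*-semiring
  using (sum-syntax; sum-cong-≗; sum-replicate-zero; ∑-distrib-+; ∑-permute)
open import Function using (_∘_; case_of_)
open import Function.Bundles using (_⇔_; mk⇔)
open import Level using (0ℓ)
open import Relation.Binary using (Tri; tri<; tri≈; tri>)
open import Relation.Binary.PropositionalEquality
open import Relation.Nullary using (Dec; ¬_; yes; no; contradiction)
open import Relation.Nullary.Decidable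
  using (_⊎-dec_; ⌊_⌋; does; does-⇔; isYes≗does; dec-true; dec-false)

open import Defs

open ≡-Reasoning

m*2≡m+m : ∀ m → m * 2 ≡ m + m
m*2≡m+m m = trans (*-comm m 2) (cong (m +_) (+-identityʳ m))

χ : Bool → ℕ
χ false = 0
χ true = 1

χ-∧ : ∀ a b → χ (a ∧ b) ≡ χ a * χ b
χ-∧ false b = refl
χ-∧ true b = sym (+-identityʳ (χ b))

χ-∨ : ∀ a b → a ∧ b ≡ false → χ (a ∨ b) ≡ χ a + χ b
χ-∨ false b _ = refl
χ-∨ true false _ = refl

⌊⌋-true : ∀ {A : Set} (a? : Dec A) → A → ⌊ a? ⌋ ≡ true
⌊⌋-true a? a = trans (isYes≗does a?) (dec-true a? a)

⌊⌋-sound : ∀ {A : Set} (a? : Dec A) → ⌊ a? ⌋ ≡ true → A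
⌊⌋-sound (yes a) _ = a

⌊⌋-false : ∀ {A : Set} (a? : Dec A) → ¬ A → ⌊ a? ⌋ ≡ false
⌊⌋-false a? ¬a = trans (isYes≗does a?) (dec-false a? ¬a)

⌊⌋-⇔ : ∀ {A B : Set} → A ⇔ B → (a? : Dec A) (b? : Dec B) → ⌊ a? ⌋ ≡ ⌊ b? ⌋
⌊⌋-⇔ A⇔B a? b? = trans (isYes≗does a?) (trans (does-⇔ A⇔B a? b?) (sym (isYes≗does b?)))

χ-not : ∀ a → χ a + χ (not a) ≡ 1
χ-not false = refl
χ-not true = refl

length-filter≡sum : ∀ {A : Set} (p : A → Bool) xs →
  length (filter (λ x → p x ≟B true) xs) ≡ sumˡ (map (χ ∘ p) xs)
length-filter≡sum p [] = refl
length-filter≡sum p (x ∷ xs) with p x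
... | true = cong suc (length-filter≡sum p xs)
... | false = length-filter≡sum p xs

length≡sum-map-1 : ∀ {A : Set} (xs : List A) → length xs ≡ sumˡ (map (λ _ → 1) xs)
length≡sum-map-1 [] = refl
length≡sum-map-1 (x ∷ xs) = cong suc (length≡sum-map-1 xs)

filter-pair≡1 : ∀ {A : Set} (p : A → Bool) a b →
  length (filter (λ x → p x ≟B true) (a ∷ b ∷ [])) ≡ 1 → p b ≡ not (p a)
filter-pair≡1 p a b one = exactly-one (p a) (p b) (trans (sym (length-filter≡sum p (a ∷ b ∷ []))) one)
  where
  exactly-one : ∀ x y → χ x + (χ y + 0) ≡ 1 → y ≡ not x
  exactly-one true false _ = refl
  exactly-one false true _ = refl
  exactly-one true true ()
  exactly-one false false ()

sum-map-++ : ∀ {A : Set} (f : A → ℕ) xs ys → sumˡ (map f (xs ++ ys)) ≡ sumˡ (map f xs) + sumˡ (map f ys)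
sum-map-++ f xs ys = trans (cong sumˡ (map-++ f xs ys)) (sumˡ-++ (map f xs) (map f ys))

sum-map-concatMap : ∀ {A B : Set} (f : B → ℕ) (g : A → List B) xs →
  sumˡ (map f (concatMap g xs)) ≡ sumˡ (map (λ x → sumˡ (map f (g x))) xs)
sum-map-concatMap f g [] = refl
sum-map-concatMap f g (x ∷ xs) =
  trans (sum-map-++ f (g x) (concatMap g xs)) (cong (sumˡ (map f (g x)) +_) (sum-map-concatMap f g xs))

sum-map-cartesianProduct : ∀ {A B : Set} (f : A × B → ℕ) xs ys →
  sumˡ (map f (cartesianProduct xs ys)) ≡ sumˡ (map (λ x → sumˡ (map (λ y → f (x , y)) ys)) xs)
sum-map-cartesianProduct f [] ys = refl
sum-map-cartesianProduct f (x ∷ xs) ys = begin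
  sumˡ (map f (map (x ,_) ys ++ (cartesianProduct xs ys)))
    ≡⟨ sum-map-++ f (map (x ,_) ys) _ ⟩
  sumˡ (map f (map (x ,_) ys)) + sumˡ (map f (cartesianProduct xs ys))
    ≡⟨ cong₂ _+_ (cong sumˡ (sym (map-∘ ys))) (sum-map-cartesianProduct f xs ys) ⟩
  sumˡ (map (λ y → f (x , y)) ys) + sumˡ (map (λ x → sumˡ (map (λ y → f (x , y)) ys)) xs) ∎

sum-map-tabulate : ∀ {A : Set} {k} (f : A → ℕ) (g : Fin k → A) →
  sumˡ (map f (tabulate g)) ≡ ∑[ i < k ] f (g i)
sum-map-tabulate {k = zero} f g = refl
sum-map-tabulate {k = suc k} f g = cong (f (g zero) +_) (sum-map-tabulate f (g ∘ suc))

∑-const-1 : ∀ k → ∑[ i < k ] 1 ≡ k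
∑-const-1 zero = refl
∑-const-1 (suc k) = cong suc (∑-const-1 k)

∑-none : ∀ {k} (w : Fin k → ℕ) (p : Fin k → Bool) → (∀ j → p j ≡ false) →
  ∑[ j < k ] (w j * χ (p j)) ≡ 0
∑-none {k} w p none =
  trans (sum-cong-≗ (λ j → trans (cong (λ b → w j * χ b) (none j)) (*-zeroʳ (w j)))) (sum-replicate-zero k)

∑-unique : ∀ {k} (w : Fin k → ℕ) (p : Fin k → Bool) {a} → p a ≡ true →
  (∀ j → p j ≡ true → j ≡ a) → ∑[ j < k ] (w j * χ (p j)) ≡ w a
∑-unique {suc k} w p {zero} pa unique = begin
  w zero * χ (p zero) + ∑[ j < k ] (w (suc j) * χ (p (suc j)))
    ≡⟨ cong₂ _+_ (cong (λ b → w zero * χ b) pa)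
                 (∑-none (w ∘ suc) (p ∘ suc) (λ j → ¬-not (λ e → 0≢1+n (sym (unique (suc j) e))))) ⟩
  w zero * 1 + 0
    ≡⟨ trans (+-identityʳ _) (*-identityʳ _) ⟩
  w zero ∎
∑-unique {suc k} w p {suc a} pa unique =
  cong₂ _+_ (trans (cong (λ b → w zero * χ b) (¬-not (λ e → 0≢1+n (unique zero e)))) (*-zeroʳ (w zero)))
            (∑-unique (w ∘ suc) (p ∘ suc) pa (λ j e → suc-injective (unique (suc j) e)))

module Dihedral (n : ℕ) .{{_ : NonZero n}} where

  infixl 6 _⊕_
  _⊕_ : C n → C n → C n
  _⊕_ = _+C_ n

  ⊖_ : C n → C n
  ⊖_ = invC n

  𝟘 : C n
  𝟘 = zeroC n

  toℕ-mod : ∀ m → toℕ (m mod n) ≡ m % n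
  toℕ-mod m = toℕ-fromℕ< _

  %-absorbˡ : ∀ a b → (a % n + b) % n ≡ (a + b) % n
  %-absorbˡ a b = begin
    (a % n + b) % n           ≡⟨ %-distribˡ-+ (a % n) b n ⟩
    (a % n % n + b % n) % n   ≡⟨ cong (λ z → (z + b % n) % n) (m%n%n≡m%n a n) ⟩
    (a % n + b % n) % n       ≡⟨ %-distribˡ-+ a b n ⟨
    (a + b) % n               ∎

  toℕ-⊕ : ∀ i j → toℕ (i ⊕ j) ≡ (toℕ i + toℕ j) % n
  toℕ-⊕ i j = toℕ-mod _

  toℕ-𝟘 : toℕ 𝟘 ≡ 0
  toℕ-𝟘 = trans (toℕ-mod 0) (m<n⇒m%n≡m (>-nonZero⁻¹ n))

  ⊕-comm : ∀ i j → i ⊕ j ≡ j ⊕ i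
  ⊕-comm i j = cong (_mod n) (+-comm (toℕ i) (toℕ j))

  ⊕-assoc : ∀ i j k → (i ⊕ j) ⊕ k ≡ i ⊕ (j ⊕ k)
  ⊕-assoc i j k = toℕ-injective (begin
    toℕ ((i ⊕ j) ⊕ k)                     ≡⟨ toℕ-⊕ (i ⊕ j) k ⟩
    (toℕ (i ⊕ j) + toℕ k) % n             ≡⟨ cong (λ z → (z + toℕ k) % n) (toℕ-⊕ i j) ⟩
    ((toℕ i + toℕ j) % n + toℕ k) % n     ≡⟨ %-absorbˡ (toℕ i + toℕ j) (toℕ k) ⟩
    (toℕ i + toℕ j + toℕ k) % n           ≡⟨ cong (_% n) (+-assoc (toℕ i) (toℕ j) (toℕ k)) ⟩
    (toℕ i + (toℕ j + toℕ k)) % n         ≡⟨ cong (_% n) (+-comm (toℕ i) _) ⟩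
    (toℕ j + toℕ k + toℕ i) % n           ≡⟨ %-absorbˡ (toℕ j + toℕ k) (toℕ i) ⟨
    ((toℕ j + toℕ k) % n + toℕ i) % n     ≡⟨ cong (_% n) (+-comm _ (toℕ i)) ⟩
    (toℕ i + (toℕ j + toℕ k) % n) % n     ≡⟨ cong (λ z → (toℕ i + z) % n) (toℕ-⊕ j k) ⟨
    (toℕ i + toℕ (j ⊕ k)) % n             ≡⟨ toℕ-⊕ i (j ⊕ k) ⟨
    toℕ (i ⊕ (j ⊕ k))                     ∎)

  ⊕-identityˡ : ∀ i → 𝟘 ⊕ i ≡ i
  ⊕-identityˡ i = toℕ-injective (begin
    toℕ (𝟘 ⊕ i)          ≡⟨ toℕ-⊕ 𝟘 i ⟩
    (toℕ 𝟘 + toℕ i) % n  ≡⟨ cong (λ z → (z + toℕ i) % n) toℕ-𝟘 ⟩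
    toℕ i % n            ≡⟨ m<n⇒m%n≡m (toℕ<n i) ⟩
    toℕ i                ∎)

  ⊕-inverseʳ : ∀ i → i ⊕ ⊖ i ≡ 𝟘
  ⊕-inverseʳ i = toℕ-injective (begin
    toℕ (i ⊕ ⊖ i)                   ≡⟨ toℕ-⊕ i (⊖ i) ⟩
    (toℕ i + toℕ (⊖ i)) % n         ≡⟨ cong (λ z → (toℕ i + z) % n) (toℕ-mod (n ∸ toℕ i)) ⟩
    (toℕ i + (n ∸ toℕ i) % n) % n   ≡⟨ cong (_% n) (+-comm (toℕ i) _) ⟩
    ((n ∸ toℕ i) % n + toℕ i) % n   ≡⟨ %-absorbˡ (n ∸ toℕ i) (toℕ i) ⟩
    (n ∸ toℕ i + toℕ i) % n         ≡⟨ cong (_% n) (+-comm _ (toℕ i)) ⟩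
    (toℕ i + (n ∸ toℕ i)) % n       ≡⟨ cong (_% n) (m+[n∸m]≡n (<⇒≤ (toℕ<n i))) ⟩
    n % n                           ≡⟨ n%n≡0 n ⟩
    0                               ≡⟨ toℕ-𝟘 ⟨
    toℕ 𝟘                           ∎)

  ⊕-identityʳ : ∀ i → i ⊕ 𝟘 ≡ i
  ⊕-identityʳ i = trans (⊕-comm i 𝟘) (⊕-identityˡ i)

  ⊕-inverseˡ : ∀ i → ⊖ i ⊕ i ≡ 𝟘
  ⊕-inverseˡ i = trans (⊕-comm (⊖ i) i) (⊕-inverseʳ i)

  ℤₙ : AbelianGroup 0ℓ 0ℓ
  ℤₙ = record
    { Carrier = C n ; _≈_ = _≡_ ; _∙_ = _⊕_ ; ε = 𝟘 ; _⁻¹ = ⊖_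
    ; isAbelianGroup = record
      { isGroup = record
        { isMonoid = record
          { isSemigroup = record
            { isMagma = record { isEquivalence = isEquivalence ; ∙-cong = cong₂ _⊕_ }
            ; assoc = ⊕-assoc }
          ; identity = ⊕-identityˡ , ⊕-identityʳ }
        ; inverse = ⊕-inverseˡ , ⊕-inverseʳ
        ; ⁻¹-cong = cong ⊖_ }
      ; comm = ⊕-comm } }

  private
    module ℤ = AbelianGroupProperties ℤₙ

  maximal-skew-complete : ∀ M → IsMaximalSkewC n M → ∀ x → ⊖ x ≢ x → M x ≡ false → M (⊖ x) ≡ true
  maximal-skew-complete M (skew , maximal) x ⊖x≢x x∉M with M (⊖ x) in ⊖x∈?M
  ... | true = refl
  ... | false = contradiction (trans (sym (maximal T T-skew M⊆T x x∈T)) x∉M) λ ()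
    where
    T : SubC n
    T j = M j ∨ ⌊ j ≟ x ⌋

    M⊆T : ∀ j → M j ≡ true → T j ≡ true
    M⊆T j j∈M = cong (_∨ ⌊ j ≟ x ⌋) j∈M

    x∈T : T x ≡ true
    x∈T = trans (cong (_∨ ⌊ x ≟ x ⌋) x∉M) (⌊⌋-true (x ≟ x) refl)

    T-skew : IsSkewC n T
    T-skew j j∈T with M j in j∈?M
    ... | true = cong₂ _∨_ (skew j j∈?M) (⌊⌋-false (⊖ j ≟ x) ⊖j≢x)
      where
      ⊖j≢x : ⊖ j ≢ x
      ⊖j≢x ⊖j≡x = contradiction (trans (sym j∈?M) (trans (cong M j≡⊖x) ⊖x∈?M)) λ ()
        where
        j≡⊖x : j ≡ ⊖ x
        j≡⊖x = trans (sym (ℤ.⁻¹-involutive j)) (cong ⊖_ ⊖j≡x)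
    ... | false with refl ← ⌊⌋-sound (j ≟ x) j∈T = cong₂ _∨_ ⊖x∈?M (⌊⌋-false (⊖ x ≟ x) ⊖x≢x)

  -- The dihedral group D_n

  -- σ a is the automorphism of C_n given by conjugation with t^a.
  σ : Bool → C n → C n
  σ false j = j
  σ true j = ⊖ j

  σ-⊕ : ∀ a j k → σ a (j ⊕ k) ≡ σ a j ⊕ σ a k
  σ-⊕ false j k = refl
  σ-⊕ true j k = sym (ℤ.⁻¹-∙-comm j k)

  σ-xor : ∀ a b k → σ a (σ b k) ≡ σ (a xor b) k
  σ-xor false b k = refl
  σ-xor true false k = refl
  σ-xor true true k = ℤ.⁻¹-involutive k

  infixl 7 _·_
  _·_ : D n → D n → D n
  _·_ = _·D_ n

  ·-σ : ∀ i a j b → (i , a) · (j , b) ≡ (i ⊕ σ a j , a xor b)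
  ·-σ i false j b = refl
  ·-σ i true j b = refl

  ·-assoc : ∀ x y z → (x · y) · z ≡ x · (y · z)
  ·-assoc (i , a) (j , b) (k , c) = begin
    ((i , a) · (j , b)) · (k , c)
      ≡⟨ trans (cong (_· (k , c)) (·-σ i a j b)) (·-σ _ (a xor b) k c) ⟩
    ((i ⊕ σ a j) ⊕ σ (a xor b) k , (a xor b) xor c)
      ≡⟨ cong₂ _,_ rotation (xor-assoc a b c) ⟩
    (i ⊕ σ a (j ⊕ σ b k) , a xor (b xor c))
      ≡⟨ trans (cong ((i , a) ·_) (·-σ j b k c)) (·-σ i a _ (b xor c)) ⟨
    (i , a) · ((j , b) · (k , c)) ∎
    where
    rotation : (i ⊕ σ a j) ⊕ σ (a xor b) k ≡ i ⊕ σ a (j ⊕ σ b k)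
    rotation = begin
      (i ⊕ σ a j) ⊕ σ (a xor b) k    ≡⟨ ⊕-assoc i (σ a j) _ ⟩
      i ⊕ (σ a j ⊕ σ (a xor b) k)    ≡⟨ cong (λ z → i ⊕ (σ a j ⊕ z)) (σ-xor a b k) ⟨
      i ⊕ (σ a j ⊕ σ a (σ b k))      ≡⟨ cong (i ⊕_) (σ-⊕ a j (σ b k)) ⟨
      i ⊕ σ a (j ⊕ σ b k)            ∎

  ·-identityˡ : ∀ x → eD n · x ≡ x
  ·-identityˡ (i , b) = cong (_, b) (⊕-identityˡ i)

  ·-identityʳ : ∀ x → x · eD n ≡ x
  ·-identityʳ (i , false) = cong (_, false) (⊕-identityʳ i)
  ·-identityʳ (i , true) = cong (_, true) (trans (cong (i ⊕_) ℤ.ε⁻¹≈ε) (⊕-identityʳ i))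

  ·-inverseˡ : ∀ x → invD n x · x ≡ eD n
  ·-inverseˡ (i , false) = cong (_, false) (⊕-inverseˡ i)
  ·-inverseˡ (i , true) = cong (_, false) (⊕-inverseʳ i)

  ·-inverseʳ : ∀ x → x · invD n x ≡ eD n
  ·-inverseʳ (i , false) = cong (_, false) (⊕-inverseʳ i)
  ·-inverseʳ (i , true) = cong (_, false) (⊕-inverseʳ i)

  Dₙ : Group 0ℓ 0ℓ
  Dₙ = record
    { Carrier = D n ; _≈_ = _≡_ ; _∙_ = _·_ ; ε = eD n ; _⁻¹ = invD n
    ; isGroup = record
      { isMonoid = record
        { isSemigroup = record
          { isMagma = record { isEquivalence = isEquivalence ; ∙-cong = cong₂ _·_ }
          ; assoc = ·-assoc }
        ; identity = ·-identityˡ , ·-identityʳ }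
      ; inverse = ·-inverseˡ , ·-inverseʳ
      ; ⁻¹-cong = cong (invD n) } }

  private
    module 𝔻 = GroupProperties Dₙ

  infix 4 _≡ᵇ_
  _≡ᵇ_ : D n → D n → Bool
  _≡ᵇ_ = _==D_ n

  ≡ᵇ⇒≡ : ∀ x y → (x ≡ᵇ y) ≡ true → x ≡ y
  ≡ᵇ⇒≡ (i , a) (j , b) eq with i ≟ j | a ≟B b
  ≡ᵇ⇒≡ (i , a) (i , a) eq | yes refl | yes refl = refl
  ≡ᵇ⇒≡ (i , a) (j , b) () | yes _ | no _
  ≡ᵇ⇒≡ (i , a) (j , b) () | no _ | _

  ≡⇒≡ᵇ : ∀ {x y} → x ≡ y → (x ≡ᵇ y) ≡ true
  ≡⇒≡ᵇ {i , a} refl = cong₂ _∧_ (⌊⌋-true (i ≟ i) refl) (⌊⌋-true (a ≟B a) refl)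

  ∑D : (D n → ℕ) → ℕ
  ∑D F = ∑[ i < n ] F (i , false) + ∑[ i < n ] F (i , true)

  ∑D-cong : ∀ {F G : D n → ℕ} → (∀ x → F x ≡ G x) → ∑D F ≡ ∑D G
  ∑D-cong F≗G = cong₂ _+_ (sum-cong-≗ (λ i → F≗G (i , false))) (sum-cong-≗ (λ i → F≗G (i , true)))

  ∑D-distrib-+ : ∀ (F G : D n → ℕ) → ∑D (λ x → F x + G x) ≡ ∑D F + ∑D G
  ∑D-distrib-+ F G = trans
    (cong₂ _+_ (∑-distrib-+ (λ i → F (i , false)) (λ i → G (i , false)))
               (∑-distrib-+ (λ i → F (i , true)) (λ i → G (i , true))))
    (+-interchange (∑[ i < n ] F (i , false)) _ _ _)

  sum-map-allD : ∀ F → sumˡ (map F (allD n)) ≡ ∑D F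
  sum-map-allD F = begin
    sumˡ (map F (allD n))
      ≡⟨ sum-map-concatMap F _ (allFin n) ⟩
    sumˡ (map (λ i → F (i , false) + (F (i , true) + 0)) (allFin n))
      ≡⟨ sum-map-tabulate (λ i → F (i , false) + (F (i , true) + 0)) (λ i → i) ⟩
    ∑[ i < n ] (F (i , false) + (F (i , true) + 0))
      ≡⟨ sum-cong-≗ (λ i → cong (F (i , false) +_) (+-identityʳ _)) ⟩
    ∑[ i < n ] (F (i , false) + F (i , true))
      ≡⟨ ∑-distrib-+ (λ i → F (i , false)) (λ i → F (i , true)) ⟩
    ∑D F ∎

  length-allD : length (allD n) ≡ 2 * n
  length-allD = begin
    length (allD n)                    ≡⟨ length≡sum-map-1 (allD n) ⟩
    sumˡ (map (λ _ → 1) (allD n))      ≡⟨ sum-map-allD (λ _ → 1) ⟩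
    ∑[ i < n ] 1 + ∑[ i < n ] 1        ≡⟨ cong₂ _+_ (∑-const-1 n) (∑-const-1 n) ⟩
    n + n                              ≡⟨ cong (n +_) (+-identityʳ n) ⟨
    2 * n                              ∎

  ∑D-unique : ∀ (F : D n → ℕ) (p : D n → Bool) {a} → p a ≡ true → (∀ y → p y ≡ true → y ≡ a) →
    ∑D (λ y → F y * χ (p y)) ≡ F a
  ∑D-unique F p {i , false} pa unique = trans
    (cong₂ _+_ (∑-unique (λ j → F (j , false)) (λ j → p (j , false)) pa (λ j → cong proj₁ ∘ unique _))
               (∑-none (λ j → F (j , true)) (λ j → p (j , true)) (λ j → ¬-not ((λ ()) ∘ cong proj₂ ∘ unique _))))
    (+-identityʳ _)
  ∑D-unique F p {i , true} pa unique = cong₂ _+_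
    (∑-none (λ j → F (j , false)) (λ j → p (j , false)) (λ j → ¬-not ((λ ()) ∘ cong proj₂ ∘ unique _)))
    (∑-unique (λ j → F (j , true)) (λ j → p (j , true)) pa (λ j → cong proj₁ ∘ unique _))

  ∑D-δ : ∀ (F : D n → ℕ) x g → ∑D (λ y → F y * χ (x · y ≡ᵇ g)) ≡ F (invD n x · g)
  ∑D-δ F x g = ∑D-unique F (λ y → x · y ≡ᵇ g)
    (≡⇒≡ᵇ (𝔻.\\-leftDividesˡ x g)) (λ y e → 𝔻.y≈x\\z x y g (≡ᵇ⇒≡ _ _ e))

  reps≡convolution : ∀ T g → reps n T g ≡ ∑D (λ x → χ (T x) * χ (T (invD n x · g)))
  reps≡convolution T g = begin
    reps n T g
      ≡⟨ length-filter≡sum (λ p → T (proj₁ p) ∧ T (proj₂ p) ∧ (proj₁ p · proj₂ p ≡ᵇ g)) D×D ⟩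
    sumˡ (map (λ p → χ-pair (proj₁ p) (proj₂ p)) D×D)
      ≡⟨ sum-map-cartesianProduct (λ p → χ-pair (proj₁ p) (proj₂ p)) (allD n) (allD n) ⟩
    sumˡ (map (λ x → sumˡ (map (χ-pair x) (allD n))) (allD n))
      ≡⟨ sum-map-allD (λ x → sumˡ (map (χ-pair x) (allD n))) ⟩
    ∑D (λ x → sumˡ (map (χ-pair x) (allD n)))
      ≡⟨ ∑D-cong (λ x → sum-map-allD (χ-pair x)) ⟩
    ∑D (λ x → ∑D (χ-pair x))
      ≡⟨ ∑D-cong (λ x → ∑D-cong (λ y → χ-∧∧ (T x) (T y) (x · y ≡ᵇ g))) ⟩
    ∑D (λ x → ∑D (λ y → χ (T x) * χ (T y) * χ (x · y ≡ᵇ g)))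
      ≡⟨ ∑D-cong (λ x → ∑D-δ (λ y → χ (T x) * χ (T y)) x g) ⟩
    ∑D (λ x → χ (T x) * χ (T (invD n x · g))) ∎
    where
    D×D = cartesianProduct (allD n) (allD n)
    χ-pair : D n → D n → ℕ
    χ-pair x y = χ (T x ∧ T y ∧ (x · y ≡ᵇ g))
    χ-∧∧ : ∀ a b c → χ (a ∧ b ∧ c) ≡ χ a * χ b * χ c
    χ-∧∧ a b c = trans (trans (χ-∧ a (b ∧ c)) (cong (χ a *_) (χ-∧ b c))) (sym (*-assoc (χ a) _ _))

  card≡∑ : ∀ T → card n T ≡ ∑D (χ ∘ T)
  card≡∑ T = trans (length-filter≡sum T (allD n)) (sum-map-allD (χ ∘ T))

  χ-addElem : ∀ S g₀ → S g₀ ≡ false → ∀ y → χ (addElem n S g₀ y) ≡ χ (S y) + χ (y ≡ᵇ g₀)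
  χ-addElem S g₀ g₀∉S y = χ-∨ (S y) (y ≡ᵇ g₀) disjoint
    where
    disjoint : S y ∧ (y ≡ᵇ g₀) ≡ false
    disjoint with y ≡ᵇ g₀ in y≡g₀
    ... | false = ∧-zeroʳ (S y)
    ... | true = trans (∧-identityʳ (S y)) (trans (cong S (≡ᵇ⇒≡ y g₀ y≡g₀)) g₀∉S)

  ∑D-point : ∀ g₀ → ∑D (λ y → χ (y ≡ᵇ g₀)) ≡ 1
  ∑D-point g₀ = trans (∑D-cong (λ y → sym (*-identityˡ (χ (y ≡ᵇ g₀)))))
                      (∑D-unique (λ _ → 1) (_≡ᵇ g₀) (≡⇒≡ᵇ {g₀} refl) (λ y → ≡ᵇ⇒≡ y g₀))

  card-addElem : ∀ S g₀ → S g₀ ≡ false → card n (addElem n S g₀) ≡ card n S + 1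
  card-addElem S g₀ g₀∉S = begin
    card n (addElem n S g₀)              ≡⟨ card≡∑ _ ⟩
    ∑D (χ ∘ addElem n S g₀)              ≡⟨ ∑D-cong (χ-addElem S g₀ g₀∉S) ⟩
    ∑D (λ y → χ (S y) + χ (y ≡ᵇ g₀))     ≡⟨ ∑D-distrib-+ (χ ∘ S) (λ y → χ (y ≡ᵇ g₀)) ⟩
    ∑D (χ ∘ S) + ∑D (λ y → χ (y ≡ᵇ g₀))  ≡⟨ cong₂ _+_ (sym (card≡∑ S)) (∑D-point g₀) ⟩
    card n S + 1                         ∎

  reps-addElem : ∀ S g₀ → S g₀ ≡ false → ∀ g →
    reps n (addElem n S g₀) g ≡
      reps n S g + (χ (S (g · invD n g₀)) + χ (S (invD n g₀ · g)) + χ (invD n g₀ · g ≡ᵇ g₀))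
  reps-addElem S g₀ g₀∉S g = begin
    reps n (addElem n S g₀) g
      ≡⟨ reps≡convolution (addElem n S g₀) g ⟩
    ∑D (λ x → χ (addElem n S g₀ x) * χ (addElem n S g₀ (invD n x · g)))
      ≡⟨ ∑D-cong (λ x → cong₂ _*_ (χ-addElem S g₀ g₀∉S x) (χ-addElem S g₀ g₀∉S (invD n x · g))) ⟩
    ∑D (λ x → (s x + δ x) * (s′ x + δ′ x))
      ≡⟨ ∑D-cong (λ x → expand (s x) (δ x) (s′ x) (δ′ x)) ⟩
    ∑D (λ x → s x * s′ x + (s x * δ′ x + s′ x * δ x + δ′ x * δ x))
      ≡⟨ ∑D-distrib-+ (λ x → s x * s′ x) (λ x → s x * δ′ x + s′ x * δ x + δ′ x * δ x) ⟩
    ∑D (λ x → s x * s′ x) + ∑D (λ x → s x * δ′ x + s′ x * δ x + δ′ x * δ x)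
      ≡⟨ cong (∑D (λ x → s x * s′ x) +_)
              (∑D-distrib-+₃ (λ x → s x * δ′ x) (λ x → s′ x * δ x) (λ x → δ′ x * δ x)) ⟩
    ∑D (λ x → s x * s′ x)
      + (∑D (λ x → s x * δ′ x) + ∑D (λ x → s′ x * δ x) + ∑D (λ x → δ′ x * δ x))
      ≡⟨ cong₂ _+_ (sym (reps≡convolution S g))
                   (cong₂ _+_ (cong₂ _+_ x⁻¹g≡g₀-term (x≡g₀-term s′)) (x≡g₀-term δ′)) ⟩
    reps n S g + (χ (S (g · invD n g₀)) + χ (S (invD n g₀ · g)) + χ (invD n g₀ · g ≡ᵇ g₀)) ∎
    where
    open +-*-Solver using (solve; _:+_; _:*_; _:=_)
    s s′ δ δ′ : D n → ℕ
    s x = χ (S x)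
    s′ x = χ (S (invD n x · g))
    δ x = χ (x ≡ᵇ g₀)
    δ′ x = χ (invD n x · g ≡ᵇ g₀)

    ∑D-distrib-+₃ : ∀ (A B C : D n → ℕ) → ∑D (λ x → A x + B x + C x) ≡ ∑D A + ∑D B + ∑D C
    ∑D-distrib-+₃ A B C = trans (∑D-distrib-+ (λ x → A x + B x) C) (cong (_+ ∑D C) (∑D-distrib-+ A B))

    expand : ∀ a b c d → (a + b) * (c + d) ≡ a * c + (a * d + c * b + d * b)
    expand = solve 4 (λ a b c d → (a :+ b) :* (c :+ d) := a :* c :+ (a :* d :+ c :* b :+ d :* b)) refl

    x≡g₀-term : ∀ (F : D n → ℕ) → ∑D (λ x → F x * δ x) ≡ F g₀
    x≡g₀-term F = ∑D-unique F (_≡ᵇ g₀) (≡⇒≡ᵇ {g₀} refl) (λ y → ≡ᵇ⇒≡ y g₀)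

    x⁻¹g≡g₀-term : ∑D (λ x → s x * δ′ x) ≡ s (g · invD n g₀)
    x⁻¹g≡g₀-term = ∑D-unique s (λ x → invD n x · g ≡ᵇ g₀)
      (≡⇒≡ᵇ (sym (𝔻.y≈x\\z (g · invD n g₀) g₀ g (𝔻.//-rightDividesˡ g₀ g))))
      (λ x e → 𝔻.x≈z//y x g₀ g (trans (cong (x ·_) (sym (≡ᵇ⇒≡ _ _ e))) (𝔻.\\-leftDividesˡ x g)))

  x^h : D n
  x^h = (halfC n , false)

  ZD-sound : ∀ g → ZD n g ≡ true → g ≡ eD n ⊎ g ≡ x^h
  ZD-sound g g∈Z with g ≡ᵇ eD n in g≟ε
  ... | true = inj₁ (≡ᵇ⇒≡ g (eD n) g≟ε)
  ... | false = inj₂ (≡ᵇ⇒≡ g x^h g∈Z)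

  module _ (h≢𝟘 : halfC n ≢ 𝟘) where

    χ-ZD : ∀ z → χ (ZD n z) ≡ χ (z ≡ᵇ eD n) + χ (z ≡ᵇ x^h)
    χ-ZD z = χ-∨ (z ≡ᵇ eD n) (z ≡ᵇ x^h) disjoint
      where
      disjoint : (z ≡ᵇ eD n) ∧ (z ≡ᵇ x^h) ≡ false
      disjoint with z ≡ᵇ eD n in z≟ε
      ... | false = refl
      ... | true = ¬-not λ z≟x^h →
        h≢𝟘 (sym (cong proj₁ (trans (sym (≡ᵇ⇒≡ z (eD n) z≟ε)) (≡ᵇ⇒≡ z x^h z≟x^h))))

    coset-count : ∀ T g →
      length (filter (λ y → (T y ∧ ZD n (invD n g · y)) ≟B true) (allD n)) ≡ χ (T g) + χ (T (g · x^h))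
    coset-count T g = begin
      length (filter (λ y → (T y ∧ ZD n (g⁻¹ · y)) ≟B true) (allD n))
        ≡⟨ length-filter≡sum (λ y → T y ∧ ZD n (g⁻¹ · y)) (allD n) ⟩
      sumˡ (map (λ y → χ (T y ∧ ZD n (g⁻¹ · y))) (allD n))
        ≡⟨ sum-map-allD (λ y → χ (T y ∧ ZD n (g⁻¹ · y))) ⟩
      ∑D (λ y → χ (T y ∧ ZD n (g⁻¹ · y)))
        ≡⟨ ∑D-cong split ⟩
      ∑D (λ y → t y * δ₀ y + t y * δₕ y)
        ≡⟨ ∑D-distrib-+ (λ y → t y * δ₀ y) (λ y → t y * δₕ y) ⟩
      ∑D (λ y → t y * δ₀ y) + ∑D (λ y → t y * δₕ y)
        ≡⟨ cong₂ _+_ (∑D-δ t g⁻¹ (eD n)) (∑D-δ t g⁻¹ x^h) ⟩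
      t (invD n g⁻¹ · eD n) + t (invD n g⁻¹ · x^h)
        ≡⟨ cong₂ (λ x y → t x + t (y · x^h)) (trans (·-identityʳ _) (𝔻.⁻¹-involutive g)) (𝔻.⁻¹-involutive g) ⟩
      t g + t (g · x^h) ∎
      where
      g⁻¹ = invD n g
      t δ₀ δₕ : D n → ℕ
      t = χ ∘ T
      δ₀ y = χ (g⁻¹ · y ≡ᵇ eD n)
      δₕ y = χ (g⁻¹ · y ≡ᵇ x^h)
      split : ∀ y → χ (T y ∧ ZD n (g⁻¹ · y)) ≡ t y * δ₀ y + t y * δₕ y
      split y = trans (χ-∧ (T y) _) (trans (cong (t y *_) (χ-ZD (g⁻¹ · y))) (*-distribˡ-+ (t y) (δ₀ y) (δₕ y)))

  -- The subgroup H = ⟨n/2⟩ of ℤ/n for even n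

  module Even (q : ℕ) (n≡q*2 : n ≡ q * 2) where

    h : C n
    h = halfC n

    q+q≡n : q + q ≡ n
    q+q≡n = sym (trans n≡q*2 (m*2≡m+m q))

    q≢0 : q ≢ 0
    q≢0 q≡0 = ≢-nonZero⁻¹ n (trans n≡q*2 (cong (_* 2) q≡0))

    q<n : q < n
    q<n = subst (q <_) q+q≡n (m<m+n q (n≢0⇒n>0 q≢0))

    toℕ-h : toℕ h ≡ q
    toℕ-h = begin
      toℕ h            ≡⟨ toℕ-mod (n / 2) ⟩
      n / 2 % n        ≡⟨ cong (λ z → z / 2 % n) n≡q*2 ⟩
      q * 2 / 2 % n    ≡⟨ cong (_% n) (m*n/n≡m q 2) ⟩
      q % n            ≡⟨ m<n⇒m%n≡m q<n ⟩
      q                ∎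

    h≢𝟘 : h ≢ 𝟘
    h≢𝟘 h≡𝟘 = q≢0 (trans (sym toℕ-h) (trans (cong toℕ h≡𝟘) toℕ-𝟘))

    h⊕h≡𝟘 : h ⊕ h ≡ 𝟘
    h⊕h≡𝟘 = toℕ-injective (begin
      toℕ (h ⊕ h)            ≡⟨ toℕ-⊕ h h ⟩
      (toℕ h + toℕ h) % n    ≡⟨ cong₂ (λ a b → (a + b) % n) toℕ-h toℕ-h ⟩
      (q + q) % n            ≡⟨ cong (_% n) q+q≡n ⟩
      n % n                  ≡⟨ n%n≡0 n ⟩
      0                      ≡⟨ toℕ-𝟘 ⟨
      toℕ 𝟘                  ∎)

    InHalf : C n → Set
    InHalf x = x ≡ 𝟘 ⊎ x ≡ h

    inHalf? : ∀ x → Dec (InHalf x)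
    inHalf? x = x ≟ 𝟘 ⊎-dec x ≟ h

    ⊕-self≡𝟘⇒InHalf : ∀ x → x ⊕ x ≡ 𝟘 → InHalf x
    ⊕-self≡𝟘⇒InHalf x x⊕x≡𝟘 = by-size (<-cmp a q)
      where
      a = toℕ x

      [a+a]%n≡0 : (a + a) % n ≡ 0
      [a+a]%n≡0 = trans (sym (toℕ-⊕ x x)) (trans (cong toℕ x⊕x≡𝟘) toℕ-𝟘)

      by-size : Tri (a < q) (a ≡ q) (q < a) → InHalf x
      by-size (tri< a<q _ _) = inj₁ (toℕ-injective (trans a≡0 (sym toℕ-𝟘)))
        where
        a+a<n : a + a < n
        a+a<n = subst (a + a <_) q+q≡n (+-mono-< a<q a<q)
        a≡0 : a ≡ 0
        a≡0 = m+n≡0⇒m≡0 a (trans (sym (m<n⇒m%n≡m a+a<n)) [a+a]%n≡0)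
      by-size (tri≈ _ a≡q _) = inj₂ (toℕ-injective (trans a≡q (sym toℕ-h)))
      by-size (tri> _ _ q<a) = contradiction (m∸n≡0⇒m≤n [a+a]∸n≡0) (<⇒≱ n<a+a)
        where
        n<a+a : n < a + a
        n<a+a = subst (_< a + a) q+q≡n (+-mono-< q<a q<a)
        [a+a]∸n<n : a + a ∸ n < n
        [a+a]∸n<n = subst (a + a ∸ n <_) (m+n∸n≡m n n)
                          (∸-monoˡ-< (+-mono-< (toℕ<n x) (toℕ<n x)) (<⇒≤ n<a+a))
        -- a + a lies strictly between n and 2n, so it cannot be a multiple of n
        [a+a]∸n≡0 : a + a ∸ n ≡ 0
        [a+a]∸n≡0 = trans (sym (m<n⇒m%n≡m [a+a]∸n<n)) (trans (m≤n⇒[n∸m]%m≡n%m (<⇒≤ n<a+a)) [a+a]%n≡0)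

    ⊖-InHalf : ∀ {x} → InHalf x → ⊖ x ≡ x
    ⊖-InHalf (inj₁ refl) = ℤ.ε⁻¹≈ε
    ⊖-InHalf (inj₂ refl) = sym (ℤ.inverseʳ-unique h h h⊕h≡𝟘)

    ⊖-self⇒InHalf : ∀ x → ⊖ x ≡ x → InHalf x
    ⊖-self⇒InHalf x ⊖x≡x = ⊕-self≡𝟘⇒InHalf x (trans (cong (x ⊕_) (sym ⊖x≡x)) (⊕-inverseʳ x))

    InHalf-⊕ : ∀ {a b} → InHalf a → InHalf b → InHalf (a ⊕ b)
    InHalf-⊕ (inj₁ refl) (inj₁ refl) = inj₁ (⊕-identityˡ 𝟘)
    InHalf-⊕ (inj₁ refl) (inj₂ refl) = inj₂ (⊕-identityˡ h)
    InHalf-⊕ (inj₂ refl) (inj₁ refl) = inj₂ (⊕-identityʳ h)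
    InHalf-⊕ (inj₂ refl) (inj₂ refl) = inj₁ h⊕h≡𝟘

    ⊕-InHalf-twice : ∀ {c} → InHalf c → ∀ x → x ⊕ c ⊕ c ≡ x
    ⊕-InHalf-twice {c} c∈H x = begin
      x ⊕ c ⊕ c     ≡⟨ ⊕-assoc x c c ⟩
      x ⊕ (c ⊕ c)   ≡⟨ cong (λ z → x ⊕ (c ⊕ z)) (⊖-InHalf c∈H) ⟨
      x ⊕ (c ⊕ ⊖ c) ≡⟨ cong (x ⊕_) (⊕-inverseʳ c) ⟩
      x ⊕ 𝟘         ≡⟨ ⊕-identityʳ x ⟩
      x             ∎

    ι : C n → ℕ
    ι x = χ (inHalfSub n x)

    inHalfSub≡does : ∀ x → inHalfSub n x ≡ does (inHalf? x)
    inHalfSub≡does x = cong₂ _∨_ (isYes≗does (x ≟ 𝟘)) (isYes≗does (x ≟ h))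

    ι≡χ-inHalf? : ∀ x → ι x ≡ χ (does (inHalf? x))
    ι≡χ-inHalf? x = cong χ (inHalfSub≡does x)

    inHalfSub-no : ∀ {x} → ¬ InHalf x → inHalfSub n x ≡ false
    inHalfSub-no {x} x∉H = trans (inHalfSub≡does x) (dec-false (inHalf? x) x∉H)

    ι-yes : ∀ {x} → InHalf x → ι x ≡ 1
    ι-yes {x} x∈H = trans (ι≡χ-inHalf? x) (cong χ (dec-true (inHalf? x) x∈H))

    ι-no : ∀ {x} → ¬ InHalf x → ι x ≡ 0
    ι-no {x} x∉H = trans (ι≡χ-inHalf? x) (cong χ (dec-false (inHalf? x) x∉H))

    ι-split : ∀ x → ι x ≡ χ ⌊ x ≟ 𝟘 ⌋ + χ ⌊ x ≟ h ⌋
    ι-split x = χ-∨ ⌊ x ≟ 𝟘 ⌋ ⌊ x ≟ h ⌋ disjoint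
      where
      disjoint : ⌊ x ≟ 𝟘 ⌋ ∧ ⌊ x ≟ h ⌋ ≡ false
      disjoint with x ≟ 𝟘
      ... | yes refl = ⌊⌋-false (𝟘 ≟ h) (h≢𝟘 ∘ sym)
      ... | no _ = refl

    ι-translate : ∀ {c} → InHalf c → ∀ x → ι (x ⊕ c) ≡ ι x
    ι-translate {c} c∈H x = begin
      ι (x ⊕ c)                    ≡⟨ ι≡χ-inHalf? (x ⊕ c) ⟩
      χ (does (inHalf? (x ⊕ c)))
        ≡⟨ cong χ (does-⇔ (mk⇔ to (λ x∈H → InHalf-⊕ x∈H c∈H)) (inHalf? (x ⊕ c)) (inHalf? x)) ⟩
      χ (does (inHalf? x))         ≡⟨ ι≡χ-inHalf? x ⟨
      ι x                          ∎
      where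
      to : InHalf (x ⊕ c) → InHalf x
      to x⊕c∈H = subst InHalf (⊕-InHalf-twice c∈H x) (InHalf-⊕ x⊕c∈H c∈H)

    ∑-δ-shift : ∀ (w : C n → ℕ) k b → ∑[ i < n ] (w i * χ ⌊ i ⊕ ⊖ k ≟ b ⌋) ≡ w (b ⊕ k)
    ∑-δ-shift w k b = ∑-unique w (λ i → ⌊ i ⊕ ⊖ k ≟ b ⌋)
      (⌊⌋-true (b ⊕ k ⊕ ⊖ k ≟ b) (ℤ.//-rightDividesʳ k b))
      (λ i e → trans (sym (ℤ.//-rightDividesˡ k i)) (cong (_⊕ k) (⌊⌋-sound (i ⊕ ⊖ k ≟ b) e)))

    ∑-ι-shift : ∀ (w : C n → ℕ) k → ∑[ i < n ] (w i * ι (i ⊕ ⊖ k)) ≡ w k + w (h ⊕ k)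
    ∑-ι-shift w k = begin
      ∑[ i < n ] (w i * ι (i ⊕ ⊖ k))
        ≡⟨ sum-cong-≗ (λ i → trans (cong (w i *_) (ι-split (i ⊕ ⊖ k))) (*-distribˡ-+ (w i) _ _)) ⟩
      ∑[ i < n ] (w i * χ ⌊ i ⊕ ⊖ k ≟ 𝟘 ⌋ + w i * χ ⌊ i ⊕ ⊖ k ≟ h ⌋)
        ≡⟨ ∑-distrib-+ (λ i → w i * χ ⌊ i ⊕ ⊖ k ≟ 𝟘 ⌋) _ ⟩
      ∑[ i < n ] (w i * χ ⌊ i ⊕ ⊖ k ≟ 𝟘 ⌋) + ∑[ i < n ] (w i * χ ⌊ i ⊕ ⊖ k ≟ h ⌋)
        ≡⟨ cong₂ _+_ (trans (∑-δ-shift w k 𝟘) (cong w (⊕-identityˡ k))) (∑-δ-shift w k h) ⟩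
      w k + w (h ⊕ k) ∎

    -- Maximal skew sets with one element from each nontrivial coset of H

    module MaximalSkew (M : SubC n) (M-max : IsMaximalSkewC n M) (M-coset : OneFromEachNontrivialCoset n M) where

      m : C n → ℕ
      m = χ ∘ M

      M-InHalf : ∀ {x} → InHalf x → M x ≡ false
      M-InHalf {x} x∈H with M x in x∈?M
      ... | false = refl
      ... | true = trans (sym x∈?M) (trans (cong M (sym (⊖-InHalf x∈H))) (proj₁ M-max x x∈?M))

      M-⊖ : ∀ {x} → ¬ InHalf x → M (⊖ x) ≡ not (M x)
      M-⊖ {x} x∉H with M x in x∈?M
      ... | true = proj₁ M-max x x∈?M
      ... | false = maximal-skew-complete M M-max x (x∉H ∘ ⊖-self⇒InHalf x) x∈?M

      M-⊕h : ∀ {x} → ¬ InHalf x → M (x ⊕ h) ≡ not (M x)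
      M-⊕h {x} x∉H = filter-pair≡1 M x (x ⊕ h) (M-coset x (inHalfSub-no x∉H))

      partition : ∀ (f : C n → C n) → (∀ {x} → InHalf x → InHalf (f x)) →
        (∀ {x} → ¬ InHalf x → M (f x) ≡ not (M x)) → ∀ x → m x + m (f x) + ι x ≡ 1
      partition f f-H f-M x with inHalf? x
      ... | yes x∈H =
        cong₂ _+_ (cong₂ _+_ (cong χ (M-InHalf x∈H)) (cong χ (M-InHalf (f-H x∈H)))) (ι-yes x∈H)
      ... | no x∉H = begin
        m x + m (f x) + ι x        ≡⟨ cong₂ (λ a b → m x + χ a + b) (f-M x∉H) (ι-no x∉H) ⟩
        m x + χ (not (M x)) + 0    ≡⟨ trans (+-identityʳ _) (χ-not (M x)) ⟩
        1                          ∎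

      partition-⊖ : ∀ x → m x + m (⊖ x) + ι x ≡ 1
      partition-⊖ = partition ⊖_ (λ x∈H → subst InHalf (sym (⊖-InHalf x∈H)) x∈H) M-⊖

      partition-⊕h : ∀ x → m x + m (x ⊕ h) + ι x ≡ 1
      partition-⊕h = partition (_⊕ h) (λ x∈H → InHalf-⊕ x∈H (inj₂ refl)) M-⊕h

      ∣M∣ : ℕ
      ∣M∣ = ∑[ i < n ] m i

      ∑-translate-h : ∀ (w : C n → ℕ) → ∑[ i < n ] w (i ⊕ h) ≡ ∑[ i < n ] w i
      ∑-translate-h w = sym (∑-permute w (permutation (_⊕ h) (_⊕ h) ⊕h-involutive ⊕h-involutive))
        where
        ⊕h-involutive : ∀ x → x ⊕ h ⊕ h ≡ x
        ⊕h-involutive = ⊕-InHalf-twice (inj₂ refl)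

      ∑-ι : ∑[ i < n ] ι i ≡ 2
      ∑-ι = trans (sum-cong-≗ ι≡shifted) (∑-ι-shift (λ _ → 1) 𝟘)
        where
        ι≡shifted : ∀ i → ι i ≡ 1 * ι (i ⊕ ⊖ 𝟘)
        ι≡shifted i = sym (trans (*-identityˡ _) (cong ι (trans (cong (i ⊕_) ℤ.ε⁻¹≈ε) (⊕-identityʳ i))))

      ∣M∣+∣M∣+2≡n : ∣M∣ + ∣M∣ + 2 ≡ n
      ∣M∣+∣M∣+2≡n = begin
        ∣M∣ + ∣M∣ + 2
          ≡⟨ cong₂ (λ a b → ∣M∣ + a + b) (∑-translate-h m) ∑-ι ⟨
        ∑[ i < n ] m i + ∑[ i < n ] m (i ⊕ h) + ∑[ i < n ] ι i
          ≡⟨ cong (_+ ∑[ i < n ] ι i) (∑-distrib-+ m (λ i → m (i ⊕ h))) ⟨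
        ∑[ i < n ] (m i + m (i ⊕ h)) + ∑[ i < n ] ι i
          ≡⟨ ∑-distrib-+ (λ i → m i + m (i ⊕ h)) ι ⟨
        ∑[ i < n ] (m i + m (i ⊕ h) + ι i)
          ≡⟨ sum-cong-≗ partition-⊕h ⟩
        ∑[ i < n ] 1
          ≡⟨ ∑-const-1 n ⟩
        n ∎

      μ≡∣M∣ : (n ∸ 2) / 2 ≡ ∣M∣
      μ≡∣M∣ = begin
        (n ∸ 2) / 2                  ≡⟨ cong (λ z → (z ∸ 2) / 2) ∣M∣+∣M∣+2≡n ⟨
        (∣M∣ + ∣M∣ + 2 ∸ 2) / 2      ≡⟨ cong (_/ 2) (m+n∸n≡m (∣M∣ + ∣M∣) 2) ⟩
        (∣M∣ + ∣M∣) / 2              ≡⟨ cong (_/ 2) (m*2≡m+m ∣M∣) ⟨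
        ∣M∣ * 2 / 2                  ≡⟨ m*n/n≡m ∣M∣ 2 ⟩
        ∣M∣                          ∎

      conv : C n → ℕ
      conv k = ∑[ i < n ] (m i * (m (⊖ i ⊕ k) + m (i ⊕ ⊖ k)))

      conv+coset : ∀ k → conv k + (m k + m (h ⊕ k)) ≡ ∣M∣
      conv+coset k = begin
        conv k + (m k + m (h ⊕ k))
          ≡⟨ cong (conv k +_) (∑-ι-shift m k) ⟨
        conv k + ∑[ i < n ] (m i * ι (i ⊕ ⊖ k))
          ≡⟨ ∑-distrib-+ (λ i → m i * (m (⊖ i ⊕ k) + m (i ⊕ ⊖ k))) (λ i → m i * ι (i ⊕ ⊖ k)) ⟨
        ∑[ i < n ] (m i * (m (⊖ i ⊕ k) + m (i ⊕ ⊖ k)) + m i * ι (i ⊕ ⊖ k))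
          ≡⟨ sum-cong-≗ (λ i → trans (sym (*-distribˡ-+ (m i) _ _)) (m[i]*1 i)) ⟩
        ∣M∣ ∎
        where
        partition-at : ∀ i → m (⊖ i ⊕ k) + m (i ⊕ ⊖ k) + ι (i ⊕ ⊖ k) ≡ 1
        partition-at i = begin
          m (⊖ i ⊕ k) + m y + ι y    ≡⟨ cong (λ z → m z + m y + ι y) ⊖i⊕k≡⊖y ⟩
          m (⊖ y) + m y + ι y        ≡⟨ cong (_+ ι y) (+-comm (m (⊖ y)) (m y)) ⟩
          m y + m (⊖ y) + ι y        ≡⟨ partition-⊖ y ⟩
          1                          ∎
          where
          y = i ⊕ ⊖ k
          ⊖i⊕k≡⊖y : ⊖ i ⊕ k ≡ ⊖ y
          ⊖i⊕k≡⊖y = trans (cong (⊖ i ⊕_) (sym (ℤ.⁻¹-involutive k))) (ℤ.⁻¹-∙-comm i (⊖ k))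

        m[i]*1 : ∀ i → m i * (m (⊖ i ⊕ k) + m (i ⊕ ⊖ k) + ι (i ⊕ ⊖ k)) ≡ m i
        m[i]*1 i = trans (cong (m i *_) (partition-at i)) (*-identityʳ (m i))

      reps-MuMt : ∀ k b → reps n (MuMt n M) (k , b) ≡ conv k
      reps-MuMt k b = begin
        reps n (MuMt n M) (k , b)
          ≡⟨ reps≡convolution (MuMt n M) (k , b) ⟩
        ∑[ i < n ] (m i * m (⊖ i ⊕ k)) + ∑[ i < n ] (m i * m (i ⊕ ⊖ k))
          ≡⟨ ∑-distrib-+ (λ i → m i * m (⊖ i ⊕ k)) (λ i → m i * m (i ⊕ ⊖ k)) ⟨
        ∑[ i < n ] (m i * m (⊖ i ⊕ k) + m i * m (i ⊕ ⊖ k))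
          ≡⟨ sum-cong-≗ (λ i → *-distribˡ-+ (m i) (m (⊖ i ⊕ k)) (m (i ⊕ ⊖ k))) ⟨
        conv k ∎

      module WithReflection {c} (c∈H : InHalf c) where

        g₀ : D n
        g₀ = (c , true)

        T : SubD n
        T = addElem n (MuMt n M) g₀

        g₀∉MuMt : MuMt n M g₀ ≡ false
        g₀∉MuMt = M-InHalf c∈H

        card-T : card n T ≡ n ∸ 1
        card-T = begin
          card n T                 ≡⟨ card-addElem (MuMt n M) g₀ g₀∉MuMt ⟩
          card n (MuMt n M) + 1    ≡⟨ cong (_+ 1) (card≡∑ (MuMt n M)) ⟩
          ∣M∣ + ∣M∣ + 1            ≡⟨ cong (_∸ 1) (trans (sym (+-suc (∣M∣ + ∣M∣) 1)) ∣M∣+∣M∣+2≡n) ⟩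
          n ∸ 1                    ∎

        m[k⊕c]+m[c⊕⊖k] : ∀ k → m (k ⊕ c) + m (c ⊕ ⊖ k) ≡ m k + m (h ⊕ k)
        m[k⊕c]+m[c⊕⊖k] k = +-cancelʳ-≡ (ι k) _ _ (begin
          m (k ⊕ c) + m (c ⊕ ⊖ k) + ι k
            ≡⟨ cong₂ (λ a b → m (k ⊕ c) + m a + b) ⊖[k⊕c] (ι-translate c∈H k) ⟨
          m (k ⊕ c) + m (⊖ (k ⊕ c)) + ι (k ⊕ c)
            ≡⟨ partition-⊖ (k ⊕ c) ⟩
          1
            ≡⟨ partition-⊕h k ⟨
          m k + m (k ⊕ h) + ι k
            ≡⟨ cong (λ z → m k + m z + ι k) (⊕-comm k h) ⟩
          m k + m (h ⊕ k) + ι k ∎)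
          where
          ⊖[k⊕c] : ⊖ (k ⊕ c) ≡ c ⊕ ⊖ k
          ⊖[k⊕c] = trans (sym (ℤ.⁻¹-∙-comm k c)) (trans (cong (⊖ k ⊕_) (⊖-InHalf c∈H)) (⊕-comm (⊖ k) c))

        reps-added-by-g₀ : ∀ k b → ((k , b) ≡ᵇ eD n) ≡ false →
          m (proj₁ ((k , b) · g₀)) + m (c ⊕ ⊖ k) + χ (g₀ · (k , b) ≡ᵇ g₀) ≡ m k + m (h ⊕ k)
        reps-added-by-g₀ k b g≢ε = begin
          m (proj₁ ((k , b) · g₀)) + m (c ⊕ ⊖ k) + χ (g₀ · (k , b) ≡ᵇ g₀)
            ≡⟨ cong₂ (λ z e → m z + m (c ⊕ ⊖ k) + χ e) k·g₀ g₀g≢g₀ ⟩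
          m (k ⊕ c) + m (c ⊕ ⊖ k) + 0
            ≡⟨ trans (+-identityʳ _) (m[k⊕c]+m[c⊕⊖k] k) ⟩
          m k + m (h ⊕ k) ∎
          where
          k·g₀ : proj₁ ((k , b) · g₀) ≡ k ⊕ c
          k·g₀ = trans (cong proj₁ (·-σ k b c true)) (cong (k ⊕_) (σ-fixes-c b))
            where
            σ-fixes-c : ∀ b → σ b c ≡ c
            σ-fixes-c false = refl
            σ-fixes-c true = ⊖-InHalf c∈H
          g₀g≢g₀ : (g₀ · (k , b) ≡ᵇ g₀) ≡ false
          g₀g≢g₀ = ¬-not λ g₀g≟g₀ →
            case trans (sym (≡⇒≡ᵇ (𝔻.identityʳ-unique g₀ (k , b) (≡ᵇ⇒≡ _ _ g₀g≟g₀)))) g≢ε of λ ()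

        reps-T : ∀ g → (g ≡ᵇ eD n) ≡ false → reps n T g ≡ ∣M∣
        reps-T (k , b) g≢ε = begin
          reps n T (k , b)
            ≡⟨ reps-addElem (MuMt n M) g₀ g₀∉MuMt (k , b) ⟩
          reps n (MuMt n M) (k , b) + (m (proj₁ ((k , b) · g₀)) + m (c ⊕ ⊖ k) + χ (g₀ · (k , b) ≡ᵇ g₀))
            ≡⟨ cong₂ _+_ (reps-MuMt k b) (reps-added-by-g₀ k b g≢ε) ⟩
          conv k + (m k + m (h ⊕ k))
            ≡⟨ conv+coset k ⟩
          ∣M∣ ∎

        isSumSet-T : IsSumSet n (2 * n) (n ∸ 1) ((n ∸ 2) / 2) T
        isSumSet-T = length-allD , card-T , λ g g≢ε → trans (reps-T g g≢ε) (sym μ≡∣M∣)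

        T-rotation : ∀ i → T (i , false) ≡ M i
        T-rotation i = trans (cong (M i ∨_) (∧-zeroʳ ⌊ i ≟ c ⌋)) (∨-identityʳ (M i))

        χ-T-reflection : ∀ i → χ (T (i , true)) ≡ m i + χ ⌊ i ≟ c ⌋
        χ-T-reflection i =
          trans (χ-addElem (MuMt n M) g₀ g₀∉MuMt (i , true)) (cong (λ b → m i + χ b) (∧-identityʳ ⌊ i ≟ c ⌋))

        coset-meets-c : ∀ i → χ ⌊ i ≟ c ⌋ + χ ⌊ i ⊕ h ≟ c ⌋ ≡ ι i
        coset-meets-c i = begin
          χ ⌊ i ≟ c ⌋ + χ ⌊ i ⊕ h ≟ c ⌋
            ≡⟨ cong (λ b → χ ⌊ i ≟ c ⌋ + χ b) (⌊⌋-⇔ (mk⇔ to from) (i ⊕ h ≟ c) (i ≟ c ⊕ h)) ⟩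
          χ ⌊ i ≟ c ⌋ + χ ⌊ i ≟ c ⊕ h ⌋
            ≡⟨ H-pair c∈H ⟩
          ι i ∎
          where
          to : i ⊕ h ≡ c → i ≡ c ⊕ h
          to e = trans (sym (⊕-InHalf-twice (inj₂ refl) i)) (cong (_⊕ h) e)
          from : i ≡ c ⊕ h → i ⊕ h ≡ c
          from e = trans (cong (_⊕ h) e) (⊕-InHalf-twice (inj₂ refl) c)
          H-pair : ∀ {d} → InHalf d → χ ⌊ i ≟ d ⌋ + χ ⌊ i ≟ d ⊕ h ⌋ ≡ ι i
          H-pair (inj₁ refl) = trans (cong (λ z → χ ⌊ i ≟ 𝟘 ⌋ + χ ⌊ i ≟ z ⌋) (⊕-identityˡ h)) (sym (ι-split i))
          H-pair (inj₂ refl) = trans (cong (λ z → χ ⌊ i ≟ h ⌋ + χ ⌊ i ≟ z ⌋) h⊕h≡𝟘)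
                                     (trans (+-comm (χ ⌊ i ≟ h ⌋) _) (sym (ι-split i)))

        coset-bound : ∀ g → χ (T g) + χ (T (g · x^h)) ≤ 1
        coset-bound (i , false) =
          subst₂ _≤_ (cong₂ _+_ (cong χ (sym (T-rotation i))) (cong χ (sym (T-rotation (i ⊕ h)))))
                     (partition-⊕h i) (m≤m+n (m i + m (i ⊕ h)) (ι i))
        coset-bound (i , true) = ≤-reflexive (begin
          χ (T (i , true)) + χ (T (i ⊕ ⊖ h , true))
            ≡⟨ cong (λ z → χ (T (i , true)) + χ (T (i ⊕ z , true))) (⊖-InHalf (inj₂ refl)) ⟩
          χ (T (i , true)) + χ (T (i ⊕ h , true))
            ≡⟨ cong₂ _+_ (χ-T-reflection i) (χ-T-reflection (i ⊕ h)) ⟩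
          m i + χ ⌊ i ≟ c ⌋ + (m (i ⊕ h) + χ ⌊ i ⊕ h ≟ c ⌋)
            ≡⟨ +-interchange (m i) _ _ _ ⟩
          m i + m (i ⊕ h) + (χ ⌊ i ≟ c ⌋ + χ ⌊ i ⊕ h ≟ c ⌋)
            ≡⟨ cong (m i + m (i ⊕ h) +_) (coset-meets-c i) ⟩
          m i + m (i ⊕ h) + ι i
            ≡⟨ partition-⊕h i ⟩
          1 ∎)

        isType1-T : IsType1 n (ZD n) T
        isType1-T = disjoint , λ g _ → subst (_≤ 1) (sym (coset-count h≢𝟘 T g)) (coset-bound g)
          where
          disjoint : ∀ g → ZD n g ≡ true → T g ≡ false
          disjoint g g∈Z with ZD-sound g g∈Z
          ... | inj₁ refl = trans (T-rotation 𝟘) (M-InHalf (inj₁ refl))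
          ... | inj₂ refl = trans (T-rotation h) (M-InHalf (inj₂ refl))

theorem6p1 : (n : ℕ) .{{_ : NonZero n}} → 4 ≤ n → 2 ∣ n →
    (M : SubC n) → IsMaximalSkewC n M → OneFromEachNontrivialCoset n M →
    (IsSumSet n (2 * n) (n ∸ 1) ((n ∸ 2) / 2) (addElem n (MuMt n M) (tD n))
      × IsType1 n (ZD n) (addElem n (MuMt n M) (tD n)))
    × (IsSumSet n (2 * n) (n ∸ 1) ((n ∸ 2) / 2) (addElem n (MuMt n M) (xhalf-t n))
      × IsType1 n (ZD n) (addElem n (MuMt n M) (xhalf-t n)))
theorem6p1 n _ (divides q n≡q*2) M M-max M-coset = with-reflection (inj₁ refl) , with-reflection (inj₂ refl)
  where
  open Dihedral.Even n q n≡q*2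
  open MaximalSkew M M-max M-coset

  with-reflection : ∀ {c} → InHalf c →
    IsSumSet n (2 * n) (n ∸ 1) ((n ∸ 2) / 2) (addElem n (MuMt n M) (c , true))
      × IsType1 n (ZD n) (addElem n (MuMt n M) (c , true))
  with-reflection c∈H = isSumSet-T , isType1-T
    where open WithReflection c∈H
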